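{- Let $\Sigma$ be a finite alphabet, $n\in\mathbb N$, $\mathcal P\subseteq\Sigma^n$ nonempty, $U\in\Sigma^n$, $k'=n\cdot d(U,\mathcal P)$, $V\in\mathcal P$ with $d(U,V)=k'/n$, and $D=\{j\in[n]:U(j)\neq V(j)\}$. Let $0\leq l\leq k'$. If $\mathcal A$ is a $(U,V,l)$-distinguisher making $q$ queries, then there exists a $(U,V,l)$-distinguisher $\mathcal A'$ making at most $q$ queries that never queries an index outside $D$.
   Context: A query-making algorithm over $\Sigma^n$ with $q$ queries is a randomized algorithm that knows $n$ and runs on an input $X\in\Sigma^n$ in $q$ stages: at stage $i$ it selects an index $j_i\in[n]$ based only on $X(j_1),\ldots,X(j_{i-1})$ and its internal coin tosses and learns $X(j_i)$; after the stages it accepts or rejects based only on the queried values and its coin tosses. The normalized Hamming distance is $d(X,Y)=|\{j:X(j)\neq Y(j)\}|/n$ and $d(X,\mathcal P)=\min_{Y\in\mathcal P}d(X,Y)$. For $A\subseteq D$, $U_A\in\Sigma^n$ is defined by $U_A(j)=U(j)$ for $j\in A$ and $U_A(j)=V(j)$ for $j\notin A$. A $(U,V,l)$-distinguisher is a query-making algorithm (possibly adaptive) that accepts the input $V$ with probability at least $2/3$ and rejects every input in $\mathcal U_l=\{U_A:A\subseteq D,\ |A|=l\}$ with probability at least $2/3$; its behavior on other inputs is unconstrained.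
   Formalization: The internal coin tosses of each distinguisher induce a probability distribution with rational weights on the finitely many deterministic adaptive query strategies. -}

module Defs where

open import Data.Nat using (ℕ; zero; suc)
open import Data.Fin using (Fin)
open import Data.Fin.Properties using (_≟_)
open import Data.Fin.Subset using (Subset; _⊆_; ∣_∣; _∈_)
open import Data.Unit using (⊤)
open import Data.Bool using (Bool; true; false; not; if_then_else_)
open import Data.Vec using (tabulate; lookup)
open import Data.List using (List; []; _∷_)
open import Data.List.Relation.Unary.All using (All)
open import Data.Product using (_×_; _,_; proj₁; proj₂)
open import Data.Rational using (ℚ; 0ℚ; 1ℚ; _+_; _≤_; _/_)
open import Data.Integer using (+_)
open import Relation.Nullary.Decidable using (⌊_⌋)
open import Relation.Binary.PropositionalEquality using (_≡_)

Word : ℕ → ℕ → Set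
Word s n = Fin n → Fin s

diffSet : ∀ {s n} → Word s n → Word s n → Subset n
diffSet X Y = tabulate (λ j → not ⌊ X j ≟ Y j ⌋)

-- Unnormalised Hamming distance |{j : X j ≠ Y j}| (= n · d(X,Y)).
hamming : ∀ {s n} → Word s n → Word s n → ℕ
hamming X Y = ∣ diffSet X Y ∣

hybrid : ∀ {s n} → Word s n → Word s n → Subset n → Word s n
hybrid U V A j = if lookup A j then U j else V j

-- Deterministic adaptive query algorithm (decision tree) over Σ^n making
-- exactly q queries: a node queries index j and branches on the value read;
-- a leaf accepts (true) or rejects (false).
data Tree (s n : ℕ) : ℕ → Set where
  leaf : Bool → Tree s n zero
  node : ∀ {q} → Fin n → (Fin s → Tree s n q) → Tree s n (suc q)

run : ∀ {s n q} → Tree s n q → Word s n → Bool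
run (leaf b)   X = b
run (node j k) X = run (k (X j)) X

QueriesIn : ∀ {s n q} → Subset n → Tree s n q → Set
QueriesIn D (leaf b)   = ⊤
QueriesIn D (node j k) = (j ∈ D) × (∀ a → QueriesIn D (k a))

-- Randomized query algorithm making q queries: a finitely supported
-- probability distribution (rational weights) over the outcomes of the
-- internal coin tosses, each outcome fixing a deterministic decision tree.
RandAlg : ℕ → ℕ → ℕ → Set
RandAlg s n q = List (ℚ × Tree s n q)

totalWeight : ∀ {s n q} → RandAlg s n q → ℚ
totalWeight []            = 0ℚ
totalWeight ((w , _) ∷ r) = w + totalWeight r

IsDistribution : ∀ {s n q} → RandAlg s n q → Set
IsDistribution r = All (λ p → 0ℚ ≤ proj₁ p) r × (totalWeight r ≡ 1ℚ)

accProb : ∀ {s n q} → RandAlg s n q → Word s n → ℚ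
accProb []            X = 0ℚ
accProb ((w , t) ∷ r) X = (if run t X then w else 0ℚ) + accProb r X

AllQueriesIn : ∀ {s n q} → Subset n → RandAlg s n q → Set
AllQueriesIn D r = All (λ p → QueriesIn D (proj₂ p)) r

IsDistinguisher : ∀ {s n q} → Word s n → Word s n → ℕ → RandAlg s n q → Set
IsDistinguisher {n = n} U V l r =
  IsDistribution r ×
  ((+ 2 / 3) ≤ accProb r V) ×
  (∀ (A : Subset n) → A ⊆ diffSet U V → ∣ A ∣ ≡ l →
     accProb r (hybrid U V A) ≤ (+ 1 / 3))

{-# OPTIONS --safe #-}
-- Every input the distinguisher must handle (V and the hybrids U_A with A ⊆ D)
-- agrees with V outside D, so a query at j ∉ D always returns V j and can be
-- answered without looking. To keep the number of queries, each such query is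
-- replaced by a dummy query at a fixed d ∈ D whose answer is ignored. If D is
-- empty then l = 0 and U_∅ = V, so no distinguisher exists in the first place.
module Submission where

open import Defs
open import Data.Nat using (ℕ; _≤_)
open import Data.Nat.Properties using (≤-refl; n≤0⇒n≡0)
open import Data.Product using (_×_; Σ-syntax; _,_; proj₂; map₂)
open import Data.Fin using (Fin)
open import Data.Fin.Properties using (_≟_)
open import Data.Fin.Subset using (Subset; ⊥; ∣_∣; _∈_; _∉_; _⊆_; Empty)
open import Data.Fin.Subset.Properties using (_∈?_; nonempty?; Empty-unique; ∣⊥∣≡0; ⊥⊆)
open import Data.Bool using (true; false; not)
open import Data.Vec using (lookup)
open import Data.Vec.Properties using (lookup∘tabulate; lookup⇒[]=)
open import Data.List using ([]; _∷_; map)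
open import Data.List.Relation.Unary.All using (universal)
open import Data.List.Relation.Unary.All.Properties using (map⁺)
open import Data.Rational using (_/_)
import Data.Rational as ℚ
open import Data.Rational.Properties using (≤-trans; _≤?_)
open import Data.Integer using (+_)
open import Data.Unit using (tt)
open import Data.Empty using (⊥-elim)
open import Function using (_∘_)
open import Relation.Nullary using (yes; no; ¬_)
open import Relation.Nullary.Decidable using (⌊_⌋; decidable-stable; isYes≗does; dec-false; toWitnessFalse)
open import Relation.Binary.PropositionalEquality
open ≡-Reasoning

private
  variable
    s n q q′ l : ℕ

AgreeOutside : Subset n → Word s n → Word s n → Set
AgreeOutside D X V = ∀ j → j ∉ D → X j ≡ V j

≢⇒∈-diffSet : {U V : Word s n} {j : Fin n} → U j ≢ V j → j ∈ diffSet U V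
≢⇒∈-diffSet {U = U} {V} {j} U≢V = lookup⇒[]= j (diffSet U V) (begin
  lookup (diffSet U V) j   ≡⟨ lookup∘tabulate _ j ⟩
  not ⌊ U j ≟ V j ⌋         ≡⟨ cong not (trans (isYes≗does (U j ≟ V j)) (dec-false (U j ≟ V j) U≢V)) ⟩
  true                     ∎)

∉-diffSet⇒≡ : {U V : Word s n} {j : Fin n} → j ∉ diffSet U V → U j ≡ V j
∉-diffSet⇒≡ {U = U} {V} {j} j∉D = decidable-stable (U j ≟ V j) (j∉D ∘ ≢⇒∈-diffSet)

hybrid-agreeOutside-diffSet : (U V : Word s n) (A : Subset n) →
                              AgreeOutside (diffSet U V) (hybrid U V A) V
hybrid-agreeOutside-diffSet U V A j j∉D with lookup A j
... | true  = ∉-diffSet⇒≡ j∉D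
... | false = refl

hamming-Empty : (U V : Word s n) → Empty (diffSet U V) → hamming U V ≡ 0
hamming-Empty {n = n} U V empty = trans (cong ∣_∣ (Empty-unique empty)) (∣⊥∣≡0 n)

run-cong : (t : Tree s n q) {X Y : Word s n} → (∀ j → X j ≡ Y j) → run t X ≡ run t Y
run-cong (leaf b)   X≗Y = refl
run-cong (node j k) {Y = Y} X≗Y rewrite X≗Y j = run-cong (k (Y j)) X≗Y

accProb-cong : (r : RandAlg s n q) {X Y : Word s n} → (∀ j → X j ≡ Y j) → accProb r X ≡ accProb r Y
accProb-cong []            X≗Y = refl
accProb-cong ((w , t) ∷ r) X≗Y rewrite run-cong t X≗Y | accProb-cong r X≗Y = refl

module Confine (D : Subset n) (V : Word s n) (d : Fin n) where

  confine : Tree s n q → Tree s n q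
  confine (leaf b) = leaf b
  confine (node j k) with j ∈? D
  ... | yes _ = node j (confine ∘ k)
  ... | no  _ = node d (λ _ → confine (k (V j)))

  run-confine : (t : Tree s n q) {X : Word s n} → AgreeOutside D X V → run (confine t) X ≡ run t X
  run-confine (leaf b) X≈V = refl
  run-confine (node j k) {X} X≈V with j ∈? D
  ... | yes _   = run-confine (k (X j)) X≈V
  ... | no  j∉D rewrite X≈V j j∉D = run-confine (k (V j)) X≈V

  confine-queriesIn : d ∈ D → (t : Tree s n q) → QueriesIn D (confine t)
  confine-queriesIn d∈D (leaf b) = tt
  confine-queriesIn d∈D (node j k) with j ∈? D
  ... | yes j∈D = j∈D , λ a → confine-queriesIn d∈D (k a)
  ... | no  _   = d∈D , λ _ → confine-queriesIn d∈D (k (V j))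

mapTrees : (Tree s n q → Tree s n q′) → RandAlg s n q → RandAlg s n q′
mapTrees f = map (map₂ f)

totalWeight-mapTrees : (f : Tree s n q → Tree s n q′) (r : RandAlg s n q) →
                       totalWeight (mapTrees f r) ≡ totalWeight r
totalWeight-mapTrees f []            = refl
totalWeight-mapTrees f ((w , t) ∷ r) = cong (w ℚ.+_) (totalWeight-mapTrees f r)

IsDistribution-mapTrees : (f : Tree s n q → Tree s n q′) {r : RandAlg s n q} →
                          IsDistribution r → IsDistribution (mapTrees f r)
IsDistribution-mapTrees f {r} (nonneg , total≡1) = map⁺ nonneg , trans (totalWeight-mapTrees f r) total≡1

accProb-mapTrees : (f : Tree s n q → Tree s n q′) (X : Word s n) →
                   (∀ t → run (f t) X ≡ run t X) →
                   (r : RandAlg s n q) → accProb (mapTrees f r) X ≡ accProb r X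
accProb-mapTrees f X f-pres []            = refl
accProb-mapTrees f X f-pres ((w , t) ∷ r)
  rewrite f-pres t | accProb-mapTrees f X f-pres r = refl

AllQueriesIn-mapTrees : {D : Subset n} (f : Tree s n q → Tree s n q′) →
                        (∀ t → QueriesIn D (f t)) → (r : RandAlg s n q) →
                        AllQueriesIn D (mapTrees f r)
AllQueriesIn-mapTrees f f-in r = map⁺ (universal (f-in ∘ proj₂) r)

IsDistinguisher-mapTrees : (U V : Word s n) (f : Tree s n q → Tree s n q′) →
  (∀ t {X} → AgreeOutside (diffSet U V) X V → run (f t) X ≡ run t X) →
  {r : RandAlg s n q} → IsDistinguisher U V l r → IsDistinguisher U V l (mapTrees f r)
IsDistinguisher-mapTrees U V f f-pres {r} (distr , acceptV , rejectHybrids) =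
  IsDistribution-mapTrees f distr ,
  subst ((+ 2 / 3) ℚ.≤_) (sym (accProb-mapTrees f V (λ t → f-pres t (λ _ _ → refl)) r)) acceptV ,
  λ A A⊆D ∣A∣≡l → subst (ℚ._≤ (+ 1 / 3))
    (sym (accProb-mapTrees f (hybrid U V A) (λ t → f-pres t (hybrid-agreeOutside-diffSet U V A)) r))
    (rejectHybrids A A⊆D ∣A∣≡l)

¬IsDistinguisher-hybrid≗V : (U V : Word s n) (A : Subset n) → A ⊆ diffSet U V → ∣ A ∣ ≡ l →
                            (∀ j → hybrid U V A j ≡ V j) →
                            {r : RandAlg s n q} → ¬ IsDistinguisher U V l r
¬IsDistinguisher-hybrid≗V U V A A⊆D ∣A∣≡l hybrid≗V {r} (_ , acceptV , rejectHybrids) =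
  toWitnessFalse {a? = (+ 2 / 3) ≤? (+ 1 / 3)} tt
    (≤-trans acceptV (subst (ℚ._≤ (+ 1 / 3)) (accProb-cong r hybrid≗V) (rejectHybrids A A⊆D ∣A∣≡l)))

¬IsDistinguisher-Empty : (U V : Word s n) → l ≤ hamming U V → Empty (diffSet U V) →
                         {r : RandAlg s n q} → ¬ IsDistinguisher U V l r
¬IsDistinguisher-Empty {n = n} {l = l} U V l≤hamming empty =
  ¬IsDistinguisher-hybrid≗V U V ⊥ ⊥⊆ ∣⊥∣≡l
    (λ j → hybrid-agreeOutside-diffSet U V ⊥ j (λ j∈D → empty (j , j∈D)))
  where
  ∣⊥∣≡l : ∣ ⊥ {n} ∣ ≡ l
  ∣⊥∣≡l = trans (∣⊥∣≡0 n) (sym (n≤0⇒n≡0 (subst (_ ≤_) (hamming-Empty U V empty) l≤hamming)))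

mainTheorem4 : (s n : ℕ) (P : Word s n → Set) (U V : Word s n) →
    P V →
    (∀ Y → P Y → hamming U V ≤ hamming U Y) →
    (l : ℕ) → l ≤ hamming U V →
    (q : ℕ) (𝒜 : RandAlg s n q) → IsDistinguisher U V l 𝒜 →
    Σ[ q′ ∈ ℕ ] Σ[ 𝒜′ ∈ RandAlg s n q′ ]
    (q′ ≤ q × IsDistinguisher U V l 𝒜′ × AllQueriesIn (diffSet U V) 𝒜′)
mainTheorem4 s n P U V _ _ l l≤hamming q 𝒜 distinguishes with nonempty? (diffSet U V)
... | yes (d , d∈D) =
  q , mapTrees confine 𝒜 , ≤-refl ,
  IsDistinguisher-mapTrees U V confine run-confine distinguishes ,
  AllQueriesIn-mapTrees confine (confine-queriesIn d∈D) 𝒜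
  where open Confine (diffSet U V) V d
... | no empty = ⊥-elim (¬IsDistinguisher-Empty U V l≤hamming empty distinguishes)
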